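{- Let $V$ be a finite set, $(G_1,\ldots,G_n)$ an $n$-tuple of graphs on vertex set $V$, $A\subseteq V\times[n]$ a color-set, and $m,D>0$ integers. Let $F$ be an oriented edge-colored forest (colors in $[n]$) with a leaf $w$ and an edge $v\to w$ of color $\ell$, and let $K=F-w$. Then for every $(m,D,A)$-good embedding $\varphi:V(F)\to V$ of $F$ into $(G_1,\ldots,G_n)$, the restriction $\varphi|_{V(K)}$ is an $(m,D,A)$-good embedding of $K$.
   Context: The edges of $G_i$ are called edges of color $i$. A color-set is a subset of $V\times[n]$. For a color-set $S$, $N(S)=\bigcup_{(u,i)\in S}N_{G_i}(u)$. For an oriented forest $F$ whose edges are colored by $[n]$, an embedding is an injective map $\varphi:V(F)\to V$ such that $\varphi(u)\varphi(u')\in E(G_i)$ whenever $uu'$ is an edge of $F$ of color $i$; $\varphi(F)$ denotes $\varphi(V(F))$. An embedding $\varphi$ is $(m,D,A)$-good if for every $S\subseteq A$ with $|S|\leq m$, $$|N(S)\setminus\varphi(F)|\geq \Big|S\cap\{(\varphi(u),i): u\in V(F)\text{ has an in-edge of color } i\}\Big|+\sum_{(x,i)\in S}\big(D-d_i(x)\big),$$ where $d_i(x)$ is the number of edges of color $i$ in $F$ incident to $\varphi^{ -1}(x)$ (and $d_i(x)=0$ if $x\notin\varphi(F)$). -}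

module Defs where

open import Data.Bool using (Bool; true; false; _∧_; _∨_; not; if_then_else_)
open import Data.Nat using (ℕ; zero; suc; _+_; _≤_; _<_)
open import Data.Integer as ℤ using (ℤ; +_)
open import Data.Fin using (Fin; zero; suc; inject₁; fromℕ; punchIn; _≟_)
open import Data.Product using (Σ; ∃; _×_; _,_)
open import Data.Sum using (_⊎_)
open import Relation.Nullary using (¬_)
open import Relation.Nullary.Decidable using (⌊_⌋)
open import Relation.Binary.PropositionalEquality using (_≡_)
open import Function.Definitions using (Injective)

countF : ∀ {k} → (Fin k → Bool) → ℕ
countF {zero}  p = 0
countF {suc k} p = (if p zero then 1 else 0) + countF (λ j → p (suc j))

sumF : ∀ {k} → (Fin k → ℕ) → ℕ
sumF {zero}  f = 0
sumF {suc k} f = f zero + sumF (λ j → f (suc j))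

sumZ : ∀ {k} → (Fin k → ℤ) → ℤ
sumZ {zero}  f = + 0
sumZ {suc k} f = f zero ℤ.+ sumZ (λ j → f (suc j))

anyF : ∀ {k} → (Fin k → Bool) → Bool
anyF {zero}  p = false
anyF {suc k} p = p zero ∨ anyF (λ j → p (suc j))

_==_ : ∀ {k} → Fin k → Fin k → Bool
a == b = ⌊ a ≟ b ⌋

record Graph (N : ℕ) : Set where
  field
    adj   : Fin N → Fin N → Bool
    sym   : ∀ x y → adj x y ≡ adj y x
    irrefl : ∀ x → adj x x ≡ false
open Graph public

ColorSet : ℕ → ℕ → Set
ColorSet N n = Fin N → Fin n → Bool

card : ∀ {N n} → ColorSet N n → ℕ
card S = sumF (λ x → countF (λ i → S x i))

_⊆_ : ∀ {N n} → ColorSet N n → ColorSet N n → Set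
S ⊆ A = ∀ x i → S x i ≡ true → A x i ≡ true

-- Oriented edge-colored graphs on vertex set Fin k:
-- E a b i = true  iff  a → b is an edge of color i.

OEdges : ℕ → ℕ → Set
OEdges k n = Fin k → Fin k → Fin n → Bool

UAdj : ∀ {k n} → OEdges k n → Fin k → Fin k → Set
UAdj E a b = ∃ λ i → (E a b i ≡ true) ⊎ (E b a i ≡ true)

-- a cycle of length r+3 in the underlying graph: distinct vertices
-- c_0 … c_{r+2}, consecutive ones adjacent, and c_{r+2} adjacent to c_0
record Cycle {k n} (E : OEdges k n) : Set where
  field
    r     : ℕ
    c     : Fin (suc (suc (suc r))) → Fin k
    inj   : Injective _≡_ _≡_ c
    step  : ∀ (j : Fin (suc (suc r))) → UAdj E (c (inject₁ j)) (c (suc j))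
    close : UAdj E (c (fromℕ (suc (suc r)))) (c zero)

record IsForest {k n} (E : OEdges k n) : Set where
  field
    loopless  : ∀ a i → E a a i ≡ false
    oneColor  : ∀ a b i j → E a b i ≡ true → E a b j ≡ true → i ≡ j
    oneDir    : ∀ a b i j → E a b i ≡ true → E b a j ≡ false
    acyclic   : ¬ Cycle E

degC : ∀ {k n} → OEdges k n → Fin k → Fin n → ℕ
degC E u i = countF (λ b → E u b i ∨ E b u i)

deg : ∀ {k n} → OEdges k n → Fin k → ℕ
deg E u = sumF (λ i → degC E u i)

IsLeaf : ∀ {k n} → OEdges k n → Fin k → Set
IsLeaf E w = deg E w ≡ 1

-- F - w : vertex set Fin k, identified with V(F) ∖ {w} via punchIn w
deleteVertex : ∀ {k n} → OEdges (suc k) n → Fin (suc k) → OEdges k n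
deleteVertex E w a b i = E (punchIn w a) (punchIn w b) i

IsEmbedding : ∀ {N n k} → (Fin n → Graph N) → OEdges k n → (Fin k → Fin N) → Set
IsEmbedding G E φ =
  Injective _≡_ _≡_ φ × (∀ a b i → E a b i ≡ true → adj (G i) (φ a) (φ b) ≡ true)

module _ {N n k : ℕ} (G : Fin n → Graph N) (E : OEdges k n) (φ : Fin k → Fin N) where

  inImage : Fin N → Bool
  inImage x = anyF (λ u → φ u == x)

  nbrOutside : ColorSet N n → ℕ
  nbrOutside S = countF (λ y → not (inImage y) ∧
                   anyF (λ x → anyF (λ i → S x i ∧ adj (G i) x y)))

  hasIn : Fin k → Fin n → Bool
  hasIn u i = anyF (λ a → E a u i)

  inCount : ColorSet N n → ℕ
  inCount S = sumF (λ x → countF (λ i →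
                S x i ∧ anyF (λ u → (φ u == x) ∧ hasIn u i)))

  -- d_i(x): number of color-i edges of F at φ⁻¹(x); 0 if x ∉ φ(F).
  -- (φ is injective, so at most one summand is non-zero.)
  dC : Fin N → Fin n → ℕ
  dC x i = sumF (λ u → if φ u == x then degC E u i else 0)

  slack : ℕ → ColorSet N n → ℤ
  slack D S = sumZ (λ x → sumZ (λ i →
                if S x i then (+ D) ℤ.- (+ dC x i) else + 0))

  IsGood : ℕ → ℕ → ColorSet N n → Set
  IsGood m D A =
    IsEmbedding G E φ ×
    (∀ (S : ColorSet N n) → S ⊆ A → card S ≤ m →
       (+ inCount S) ℤ.+ slack D S ℤ.≤ + nbrOutside S)

-- Deleting the leaf w affects the goodness inequality of a color-set S only
-- through three indicator terms.  The vertex φ(w) leaves the image, and it is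
-- a neighbour of (φ(v), ℓ), so |N(S) ∖ φ(K)| gains [(φ(v),ℓ) ∈ S].  Only w
-- loses an in-edge (of color ℓ), so the in-edge count drops by at most
-- [(φ(w),ℓ) ∈ S].  The only degrees that drop are d_ℓ at φ(v) and at φ(w),
-- each by one, so the slack Σ (D − d_i(x)) grows by at most
-- [(φ(v),ℓ) ∈ S] + [(φ(w),ℓ) ∈ S], which is exactly compensated by the
-- other two changes.
module Submission where

open import Defs hiding (sym)
import Algebra.Properties.CommutativeSemigroup as CommutativeSemigroupProperties
open import Data.Bool using (Bool; true; false; _∧_; _∨_; not; if_then_else_)
open import Data.Bool.Properties using (∨-comm; ∨-zeroʳ; ∧-zeroʳ; ∧-identityʳ; T-≡; if-eta; if-float)
open import Data.Empty using (⊥-elim)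
open import Data.Fin using (Fin; zero; suc; punchIn; _≟_)
open import Data.Fin.Properties using (suc-injective; punchIn-injective; punchInᵢ≢i)
open import Data.Integer as ℤ using (ℤ; +_)
import Data.Integer.Properties as ℤₚ
open import Data.Integer.Tactic.RingSolver using (solve-∀)
open import Data.Nat using (ℕ; zero; suc; _+_; _∸_; _≤_; _<_; z≤n)
import Data.Nat.Properties as ℕₚ
open import Data.Product using (∃; _×_; _,_; proj₁; proj₂)
open import Function.Base using (_∘_)
open import Function.Bundles using (Equivalence)
open import Function.Definitions using (Injective)
open import Relation.Nullary using (¬_; yes; no)
open import Relation.Nullary.Decidable using (toWitness)
open import Relation.Binary.PropositionalEquality
  using (_≡_; _≢_; refl; sym; trans; cong; cong₂; subst; subst₂; module ≡-Reasoning)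

private
  module ℕ+ = CommutativeSemigroupProperties ℕₚ.+-commutativeSemigroup

ind : Bool → ℕ
ind b = if b then 1 else 0

ind-mono : ∀ {a b} → (a ≡ true → b ≡ true) → ind a ≤ ind b
ind-mono {false} _ = z≤n
ind-mono {true}  h rewrite h refl = ℕₚ.≤-refl

∧-intro : ∀ {a b} → a ≡ true → b ≡ true → a ∧ b ≡ true
∧-intro refl refl = refl

∧-elimˡ : ∀ a {b} → a ∧ b ≡ true → a ≡ true
∧-elimˡ true  _ = refl
∧-elimˡ false ()

∧-elimʳ : ∀ a {b} → a ∧ b ≡ true → b ≡ true
∧-elimʳ true  h = h
∧-elimʳ false ()

∨-introˡ : ∀ {a} b → a ≡ true → a ∨ b ≡ true
∨-introˡ _ refl = refl

∨-introʳ : ∀ a {b} → b ≡ true → a ∨ b ≡ true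
∨-introʳ a refl = ∨-zeroʳ a

≡⇒== : ∀ {k} {a b : Fin k} → a ≡ b → a == b ≡ true
≡⇒== {a = a} {b} a≡b with a ≟ b
... | yes _   = refl
... | no a≢b = ⊥-elim (a≢b a≡b)

≢⇒== : ∀ {k} {a b : Fin k} → a ≢ b → a == b ≡ false
≢⇒== {a = a} {b} a≢b with a ≟ b
... | yes a≡b = ⊥-elim (a≢b a≡b)
... | no _    = refl

==⇒≡ : ∀ {k} {a b : Fin k} → a == b ≡ true → a ≡ b
==⇒≡ h = toWitness (Equivalence.from T-≡ h)

anyF-intro : ∀ {k} (p : Fin k → Bool) j → p j ≡ true → anyF p ≡ true
anyF-intro p zero    pj = ∨-introˡ _ pj
anyF-intro p (suc j) pj = ∨-introʳ (p zero) (anyF-intro (p ∘ suc) j pj)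

anyF-elim : ∀ {k} (p : Fin k → Bool) → anyF p ≡ true → ∃ λ j → p j ≡ true
anyF-elim {suc k} p h with p zero in p0
... | true  = zero , p0
... | false = let j , pj = anyF-elim (p ∘ suc) h in suc j , pj

anyF-none : ∀ {k} (p : Fin k → Bool) → (∀ j → p j ≢ true) → anyF p ≡ false
anyF-none {zero}  p h = refl
anyF-none {suc k} p h with p zero in p0
... | true  = ⊥-elim (h zero p0)
... | false = anyF-none (p ∘ suc) (h ∘ suc)

countF≡sumF : ∀ {k} (p : Fin k → Bool) → countF p ≡ sumF (ind ∘ p)
countF≡sumF {zero}  p = refl
countF≡sumF {suc k} p = cong (_+_ (ind (p zero))) (countF≡sumF (p ∘ suc))

sumF-cong : ∀ {k} {f g : Fin k → ℕ} → (∀ j → f j ≡ g j) → sumF f ≡ sumF g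
sumF-cong {zero}  f≡g = refl
sumF-cong {suc k} f≡g = cong₂ _+_ (f≡g zero) (sumF-cong (f≡g ∘ suc))

sumF-+ : ∀ {k} (f g : Fin k → ℕ) → sumF (λ j → f j + g j) ≡ sumF f + sumF g
sumF-+ {zero}  f g = refl
sumF-+ {suc k} f g = trans (cong (_+_ (f zero + g zero)) (sumF-+ (f ∘ suc) (g ∘ suc)))
                           (ℕ+.interchange (f zero) (g zero) _ _)

sumF-punchIn : ∀ {k} (w : Fin (suc k)) (f : Fin (suc k) → ℕ) →
               sumF f ≡ f w + sumF (f ∘ punchIn w)
sumF-punchIn zero f = refl
sumF-punchIn {suc k} (suc w) f = trans (cong (_+_ (f zero)) (sumF-punchIn w (f ∘ suc)))
                                       (ℕ+.x∙yz≈y∙xz (f zero) (f (suc w)) _)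

countF-punchIn : ∀ {k} (w : Fin (suc k)) (p : Fin (suc k) → Bool) →
                 countF p ≡ ind (p w) + countF (p ∘ punchIn w)
countF-punchIn w p =
  trans (countF≡sumF p)
        (trans (sumF-punchIn w (ind ∘ p)) (cong (_+_ (ind (p w))) (sym (countF≡sumF (p ∘ punchIn w)))))

sumF-mono : ∀ {k} {f g : Fin k → ℕ} → (∀ j → f j ≤ g j) → sumF f ≤ sumF g
sumF-mono {zero}  f≤g = z≤n
sumF-mono {suc k} f≤g = ℕₚ.+-mono-≤ (f≤g zero) (sumF-mono (f≤g ∘ suc))

sumF-mono-at : ∀ {k} {f g : Fin k → ℕ} → (∀ j → f j ≤ g j) →
               ∀ j {c} → f j + c ≤ g j → sumF f + c ≤ sumF g
sumF-mono-at {suc k} {f} {g} f≤g j {c} fj+c≤gj = begin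
  sumF f + c                            ≡⟨ cong (_+ c) (sumF-punchIn j f) ⟩
  f j + sumF (f ∘ punchIn j) + c        ≡⟨ ℕ+.xy∙z≈xz∙y (f j) _ c ⟩
  f j + c + sumF (f ∘ punchIn j)        ≤⟨ ℕₚ.+-mono-≤ fj+c≤gj (sumF-mono (f≤g ∘ punchIn j)) ⟩
  g j + sumF (g ∘ punchIn j)            ≡⟨ sym (sumF-punchIn j g) ⟩
  sumF g                                ∎
  where open ℕₚ.≤-Reasoning

≤-sumF : ∀ {k} (f : Fin k → ℕ) j → f j ≤ sumF f
≤-sumF f zero    = ℕₚ.m≤m+n _ _
≤-sumF f (suc j) = ℕₚ.≤-trans (≤-sumF (f ∘ suc) j) (ℕₚ.m≤n+m _ _)

+-≤-sumF : ∀ {k} (f : Fin k → ℕ) {i j} → i ≢ j → f i + f j ≤ sumF f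
+-≤-sumF f {zero}  {zero}  i≢j = ⊥-elim (i≢j refl)
+-≤-sumF f {zero}  {suc j} i≢j = ℕₚ.+-monoʳ-≤ (f zero) (≤-sumF (f ∘ suc) j)
+-≤-sumF f {suc i} {zero}  i≢j =
  subst (_≤ sumF f) (ℕₚ.+-comm (f zero) (f (suc i))) (ℕₚ.+-monoʳ-≤ (f zero) (≤-sumF (f ∘ suc) i))
+-≤-sumF f {suc i} {suc j} i≢j =
  ℕₚ.≤-trans (+-≤-sumF (f ∘ suc) (i≢j ∘ cong suc)) (ℕₚ.m≤n+m _ _)

countF-mono : ∀ {k} {p q : Fin k → Bool} → (∀ j → p j ≡ true → q j ≡ true) →
              countF p ≤ countF q
countF-mono {p = p} {q} p⇒q =
  subst₂ _≤_ (sym (countF≡sumF p)) (sym (countF≡sumF q)) (sumF-mono (ind-mono ∘ p⇒q))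

countF-mono-at : ∀ {k} {p q : Fin k → Bool} → (∀ j → p j ≡ true → q j ≡ true) →
                 ∀ j {c} → ind (p j) + c ≤ ind (q j) → countF p + c ≤ countF q
countF-mono-at {p = p} {q} p⇒q j {c} h =
  subst₂ (λ a b → a + c ≤ b) (sym (countF≡sumF p)) (sym (countF≡sumF q))
         (sumF-mono-at (ind-mono ∘ p⇒q) j h)

countF-≥1 : ∀ {k} (p : Fin k → Bool) {j} → p j ≡ true → 1 ≤ countF p
countF-≥1 p {j} pj =
  subst₂ _≤_ (cong ind pj) (sym (countF≡sumF p)) (≤-sumF (ind ∘ p) j)

countF-≥2 : ∀ {k} (p : Fin k → Bool) {i j} → p i ≡ true → p j ≡ true → i ≢ j → 2 ≤ countF p
countF-≥2 p pi pj i≢j =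
  subst₂ _≤_ (cong₂ (λ a b → ind a + ind b) pi pj) (sym (countF≡sumF p)) (+-≤-sumF (ind ∘ p) i≢j)

countF-none : ∀ {k} (p : Fin k → Bool) → (∀ j → p j ≢ true) → countF p ≡ 0
countF-none {zero}  p h = refl
countF-none {suc k} p h with p zero in p0
... | true  = ⊥-elim (h zero p0)
... | false = countF-none (p ∘ suc) (h ∘ suc)

countF-≤1 : ∀ {k} (p : Fin k → Bool) → (∀ i j → p i ≡ true → p j ≡ true → i ≡ j) → countF p ≤ 1
countF-≤1 {zero}  p unique = z≤n
countF-≤1 {suc k} p unique with p zero in p0
... | true  =
  ℕₚ.≤-reflexive (cong suc (countF-none (p ∘ suc) λ j pj → zero≢suc (unique zero (suc j) p0 pj)))
  where
    zero≢suc : ∀ {j : Fin k} → zero ≢ suc j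
    zero≢suc ()
... | false = countF-≤1 (p ∘ suc) λ i j pi pj → suc-injective (unique (suc i) (suc j) pi pj)

countF-≤-ind : ∀ {k} (p : Fin k → Bool) b → (∀ i j → p i ≡ true → p j ≡ true → i ≡ j) →
               (∀ j → p j ≡ true → b ≡ true) → countF p ≤ ind b
countF-≤-ind p true  unique _   = countF-≤1 p unique
countF-≤-ind p false _      p⇒b = ℕₚ.≤-reflexive (countF-none p λ j pj → false≢true (p⇒b j pj))
  where
    false≢true : false ≢ true
    false≢true ()

sumZ-cong : ∀ {k} {f g : Fin k → ℤ} → (∀ j → f j ≡ g j) → sumZ f ≡ sumZ g
sumZ-cong {zero}  f≡g = refl
sumZ-cong {suc k} f≡g = cong₂ ℤ._+_ (f≡g zero) (sumZ-cong (f≡g ∘ suc))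

sumZ-mono : ∀ {k} {f g : Fin k → ℤ} → (∀ j → f j ℤ.≤ g j) → sumZ f ℤ.≤ sumZ g
sumZ-mono {zero}  f≤g = ℤₚ.≤-refl
sumZ-mono {suc k} f≤g = ℤₚ.+-mono-≤ (f≤g zero) (sumZ-mono (f≤g ∘ suc))

sumZ-+ : ∀ {k} (f g : Fin k → ℤ) → sumZ (λ j → f j ℤ.+ g j) ≡ sumZ f ℤ.+ sumZ g
sumZ-+ {zero}  f g = refl
sumZ-+ {suc k} f g = trans (cong (ℤ._+_ (f zero ℤ.+ g zero)) (sumZ-+ (f ∘ suc) (g ∘ suc)))
                           (ℤ+.interchange (f zero) (g zero) _ _)
  where module ℤ+ = CommutativeSemigroupProperties ℤₚ.+-commutativeSemigroup

sumZ-zero : ∀ {k} (f : Fin k → ℤ) → (∀ j → f j ≡ + 0) → sumZ f ≡ + 0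
sumZ-zero {zero}  f f≡0 = refl
sumZ-zero {suc k} f f≡0 = cong₂ ℤ._+_ (f≡0 zero) (sumZ-zero (f ∘ suc) (f≡0 ∘ suc))

sumZ-delta : ∀ {k} (f : Fin k → ℤ) j → (∀ i → i ≢ j → f i ≡ + 0) → sumZ f ≡ f j
sumZ-delta f zero f≡0 =
  trans (cong (ℤ._+_ (f zero)) (sumZ-zero (f ∘ suc) (λ i → f≡0 (suc i) λ ())))
        (ℤₚ.+-identityʳ (f zero))
sumZ-delta f (suc j) f≡0 =
  trans (cong (ℤ._+ sumZ (f ∘ suc)) (f≡0 zero λ ()))
        (trans (ℤₚ.+-identityˡ _)
               (sumZ-delta (f ∘ suc) j (λ i i≢j → f≡0 (suc i) (i≢j ∘ suc-injective))))

m-o≤m-n+p : ∀ m {n o p} → n ≤ o + p → + m ℤ.- + o ℤ.≤ (+ m ℤ.- + n) ℤ.+ + p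
m-o≤m-n+p m {n} {o} {p} n≤o+p = begin
  + m ℤ.- + o                                 ≤⟨ ℤₚ.i≤i+j _ (+ (o + p ∸ n)) ⟩
  (+ m ℤ.- + o) ℤ.+ + (o + p ∸ n)             ≡⟨ cong (ℤ._+_ (+ m ℤ.- + o)) o+p-n ⟩
  (+ m ℤ.- + o) ℤ.+ ((+ o ℤ.+ + p) ℤ.- + n)   ≡⟨ regroup (+ m) (+ n) (+ o) (+ p) ⟩
  (+ m ℤ.- + n) ℤ.+ + p                       ∎
  where
    open ℤₚ.≤-Reasoning
    o+p-n : + (o + p ∸ n) ≡ (+ o ℤ.+ + p) ℤ.- + n
    o+p-n = sym (trans (cong (ℤ._- + n) (sym (ℤₚ.pos-+ o p)))
                       (trans (ℤₚ.m-n≡m⊖n (o + p) n) (ℤₚ.⊖-≥ n≤o+p)))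
    regroup : ∀ (m n o p : ℤ) → (m ℤ.- o) ℤ.+ ((o ℤ.+ p) ℤ.- n) ≡ (m ℤ.- n) ℤ.+ p
    regroup = solve-∀

-- slack D S is definitionally sumOver S (λ x i → + D - + dC x i).
sumOver : ∀ {N n} → ColorSet N n → (Fin N → Fin n → ℤ) → ℤ
sumOver S f = sumZ (λ x → sumZ (λ i → if S x i then f x i else + 0))

module _ {N n : ℕ} (S : ColorSet N n) where

  sumOver-mono : {f g : Fin N → Fin n → ℤ} → (∀ x i → S x i ≡ true → f x i ℤ.≤ g x i) →
                 sumOver S f ℤ.≤ sumOver S g
  sumOver-mono f≤g = sumZ-mono λ x → sumZ-mono λ i → pointwise (S x i) (f≤g x i)
    where
      pointwise : ∀ s {a b} → (s ≡ true → a ℤ.≤ b) → (if s then a else + 0) ℤ.≤ (if s then b else + 0)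
      pointwise true  a≤b = a≤b refl
      pointwise false _   = ℤₚ.≤-refl

  sumOver-+ : (f g : Fin N → Fin n → ℤ) →
              sumOver S (λ x i → f x i ℤ.+ g x i) ≡ sumOver S f ℤ.+ sumOver S g
  sumOver-+ f g = begin
    sumZ (λ x → sumZ (λ i → if S x i then f x i ℤ.+ g x i else + 0))
      ≡⟨ sumZ-cong (λ x → trans (sumZ-cong λ i → pointwise (S x i)) (sumZ-+ (F x) (G x))) ⟩
    sumZ (λ x → sumZ (F x) ℤ.+ sumZ (G x))
      ≡⟨ sumZ-+ (sumZ ∘ F) (sumZ ∘ G) ⟩
    sumOver S f ℤ.+ sumOver S g ∎
    where
      open ≡-Reasoning
      F G : Fin N → Fin n → ℤ
      F x i = if S x i then f x i else + 0
      G x i = if S x i then g x i else + 0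
      pointwise : ∀ s {a b} → (if s then a ℤ.+ b else + 0) ≡ (if s then a else + 0) ℤ.+ (if s then b else + 0)
      pointwise true  = refl
      pointwise false = refl

  sumOver-point : ∀ x₀ i₀ → sumOver S (λ x i → + ind ((x₀ == x) ∧ (i == i₀))) ≡ + ind (S x₀ i₀)
  sumOver-point x₀ i₀ =
    trans (sumZ-delta _ x₀ offRow) (trans (sumZ-delta _ i₀ offColumn) atPoint)
    where
      offRow : ∀ x → x ≢ x₀ → sumZ (λ i → if S x i then + ind ((x₀ == x) ∧ (i == i₀)) else + 0) ≡ + 0
      offRow x x≢x₀ rewrite ≢⇒== (x≢x₀ ∘ sym) = sumZ-zero _ λ i → if-eta (S x i)
      offColumn : ∀ i → i ≢ i₀ → (if S x₀ i then + ind ((x₀ == x₀) ∧ (i == i₀)) else + 0) ≡ + 0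
      offColumn i i≢i₀ rewrite ≡⇒== {a = x₀} refl | ≢⇒== i≢i₀ = if-eta (S x₀ i)
      atPoint : (if S x₀ i₀ then + ind ((x₀ == x₀) ∧ (i₀ == i₀)) else + 0) ≡ + ind (S x₀ i₀)
      atPoint rewrite ≡⇒== {a = x₀} refl | ≡⇒== {a = i₀} refl = sym (if-float +_ (S x₀ i₀))

-- degC E u i is definitionally countF (λ b → joined E u b i).
joined : ∀ {k n} → OEdges k n → Fin k → Fin k → Fin n → Bool
joined E a b i = E a b i ∨ E b a i

module VertexDeletion {N n k : ℕ} (G : Fin n → Graph N) (E : OEdges (suc k) n)
                      (w : Fin (suc k)) (φ : Fin (suc k) → Fin N) where

  K : OEdges k n
  K = deleteVertex E w

  ψ : Fin k → Fin N
  ψ = φ ∘ punchIn w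

  isEmbedding-restrict : IsEmbedding G E φ → IsEmbedding G K ψ
  isEmbedding-restrict (φ-inj , φ-hom) =
    (λ {a} {b} ψa≡ψb → punchIn-injective w a b (φ-inj ψa≡ψb)) ,
    (λ a b → φ-hom (punchIn w a) (punchIn w b))

  inImage-restrict : ∀ y → inImage G K ψ y ≡ true → inImage G E φ y ≡ true
  inImage-restrict y h =
    let j , ψj==y = anyF-elim (λ j → ψ j == y) h in anyF-intro (λ u → φ u == y) (punchIn w j) ψj==y

  outside-restrict : ∀ y c → not (inImage G E φ y) ∧ c ≡ true → not (inImage G K ψ y) ∧ c ≡ true
  outside-restrict y c h with inImage G K ψ y in inK
  ... | false = ∧-elimʳ (not (inImage G E φ y)) h
  ... | true  = subst (λ a → not a ∧ c ≡ true) (inImage-restrict y inK) h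

  preimageHasIn-restrict : ∀ x i → anyF (λ j → (ψ j == x) ∧ hasIn G K ψ j i) ≡ true →
                           anyF (λ u → (φ u == x) ∧ hasIn G E φ u i) ≡ true
  preimageHasIn-restrict x i h =
    let j , ψj==x∧hasIn = anyF-elim (λ j → (ψ j == x) ∧ hasIn G K ψ j i) h
        a , a→j         = anyF-elim (λ a → K a j i) (∧-elimʳ (ψ j == x) ψj==x∧hasIn)
    in anyF-intro (λ u → (φ u == x) ∧ hasIn G E φ u i) (punchIn w j)
         (∧-intro (∧-elimˡ (ψ j == x) ψj==x∧hasIn) (anyF-intro (λ b → E b (punchIn w j) i) (punchIn w a) a→j))

  ψ≢φw : Injective _≡_ _≡_ φ → ∀ j → ψ j ≢ φ w
  ψ≢φw φ-inj j = punchInᵢ≢i w j ∘ φ-inj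

  edgesToDeleted : Fin N → Fin n → ℕ
  edgesToDeleted x i =
    countF (λ j → (ψ j == x) ∧ joined E (punchIn w j) w i)

  dC-delete : ∀ x i → dC G E φ x i ≡
              (if φ w == x then degC E w i else 0) + (dC G K ψ x i + edgesToDeleted x i)
  dC-delete x i =
    trans (sumF-punchIn w (λ u → if φ u == x then degC E u i else 0))
          (cong (_+_ (if φ w == x then degC E w i else 0))
                (trans (sumF-cong λ j → split (ψ j == x) (degC-punchIn j))
                       (trans (sumF-+ (λ j → if ψ j == x then degC K j i else 0) (ind ∘ edgeToDeleted))
                              (cong (_+_ (dC G K ψ x i)) (sym (countF≡sumF edgeToDeleted))))))
    where
      edgeToDeleted : Fin k → Bool
      edgeToDeleted j = (ψ j == x) ∧ joined E (punchIn w j) w i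
      degC-punchIn : ∀ j → degC E (punchIn w j) i ≡ ind (joined E (punchIn w j) w i) + degC K j i
      degC-punchIn j = countF-punchIn w (λ b → joined E (punchIn w j) b i)
      split : ∀ a {c d e} → d ≡ ind c + e → (if a then d else 0) ≡ (if a then e else 0) + ind (a ∧ c)
      split true  {c} {e = e} refl = ℕₚ.+-comm (ind c) e
      split false _ = refl

module LeafDeletion {N n k : ℕ} (G : Fin n → Graph N) (E : OEdges (suc k) n)
                    {v w : Fin (suc k)} {ℓ : Fin n} (leaf : IsLeaf E w) (v→w : E v w ℓ ≡ true)
                    (φ : Fin (suc k) → Fin N) (φ-inj : Injective _≡_ _≡_ φ)
                    (φ-hom : ∀ a b i → E a b i ≡ true → adj (G i) (φ a) (φ b) ≡ true) where

  open VertexDeletion G E w φ public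

  deg≱2 : ¬ (2 ≤ deg E w)
  deg≱2 2≤deg = ℕₚ.<-irrefl refl (subst (2 ≤_) leaf 2≤deg)

  v∼w : joined E w v ℓ ≡ true
  v∼w = ∨-introʳ (E w v ℓ) v→w

  edge-at-leaf : ∀ b i → joined E w b i ≡ true → b ≡ v × i ≡ ℓ
  edge-at-leaf b i h with i ≟ ℓ | b ≟ v
  ... | no i≢ℓ   | _        = ⊥-elim (deg≱2 (ℕₚ.≤-trans
          (ℕₚ.+-mono-≤ (countF-≥1 (λ b → joined E w b i) h) (countF-≥1 (λ b → joined E w b ℓ) v∼w))
          (+-≤-sumF (degC E w) i≢ℓ)))
  ... | yes refl | no b≢v   = ⊥-elim (deg≱2 (ℕₚ.≤-trans
          (countF-≥2 (λ b → joined E w b ℓ) h v∼w b≢v) (≤-sumF (degC E w) ℓ)))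
  ... | yes refl | yes refl = refl , refl

  degC-leaf : ∀ i → degC E w i ≤ ind (i == ℓ)
  degC-leaf i = countF-≤-ind _ (i == ℓ)
    (λ b b′ h h′ → trans (proj₁ (edge-at-leaf b i h)) (sym (proj₁ (edge-at-leaf b′ i h′))))
    (λ b h → ≡⇒== (proj₂ (edge-at-leaf b i h)))

  edgesToDeleted-leaf : ∀ x i → edgesToDeleted x i ≤ ind ((φ v == x) ∧ (i == ℓ))
  edgesToDeleted-leaf x i = countF-≤-ind _ _
    (λ j j′ h h′ → punchIn-injective w j j′ (trans (proj₁ (edge j h)) (sym (proj₁ (edge j′ h′)))))
    (λ j h → ∧-intro (≡⇒== (trans (cong φ (sym (proj₁ (edge j h)))) (==⇒≡ (∧-elimˡ (ψ j == x) h))))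
                     (≡⇒== (proj₂ (edge j h))))
    where
      edge : ∀ j → (ψ j == x) ∧ joined E (punchIn w j) w i ≡ true →
             punchIn w j ≡ v × i ≡ ℓ
      edge j h = edge-at-leaf (punchIn w j) i
        (trans (∨-comm (E w (punchIn w j) i) _) (∧-elimʳ (ψ j == x) h))

  δ : Fin N → Fin N → Fin n → ℕ
  δ x₀ x i = ind ((x₀ == x) ∧ (i == ℓ))

  dC-leaf-bound : ∀ x i → dC G E φ x i ≤ dC G K ψ x i + (δ (φ v) x i + δ (φ w) x i)
  dC-leaf-bound x i = begin
    dC G E φ x i
      ≡⟨ dC-delete x i ⟩
    (if φ w == x then degC E w i else 0) + (dC G K ψ x i + edgesToDeleted x i)
      ≤⟨ ℕₚ.+-mono-≤ (atLeaf (φ w == x)) (ℕₚ.+-monoʳ-≤ (dC G K ψ x i) (edgesToDeleted-leaf x i)) ⟩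
    δ (φ w) x i + (dC G K ψ x i + δ (φ v) x i)
      ≡⟨ ℕ+.x∙yz≈y∙zx (δ (φ w) x i) (dC G K ψ x i) (δ (φ v) x i) ⟩
    dC G K ψ x i + (δ (φ v) x i + δ (φ w) x i)
      ∎
    where
      open ℕₚ.≤-Reasoning
      atLeaf : ∀ a → (if a then degC E w i else 0) ≤ ind (a ∧ (i == ℓ))
      atLeaf true  = degC-leaf i
      atLeaf false = z≤n

  module _ (S : ColorSet N n) where

    nbrOutside-bound : nbrOutside G E φ S + ind (S (φ v) ℓ) ≤ nbrOutside G K ψ S
    nbrOutside-bound = countF-mono-at (λ y → outside-restrict y (inN y)) (φ w) atφw
      where
        inN : Fin N → Bool
        inN y = anyF (λ x → anyF (λ i → S x i ∧ adj (G i) x y))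
        φw∈F : inImage G E φ (φ w) ≡ true
        φw∈F = anyF-intro (λ u → φ u == φ w) w (≡⇒== refl)
        φw∉K : inImage G K ψ (φ w) ≡ false
        φw∉K = anyF-none (λ j → ψ j == φ w) (λ j → ψ≢φw φ-inj j ∘ ==⇒≡)
        atφw : ind (not (inImage G E φ (φ w)) ∧ inN (φ w)) + ind (S (φ v) ℓ) ≤
               ind (not (inImage G K ψ (φ w)) ∧ inN (φ w))
        atφw rewrite φw∈F | φw∉K =
          ind-mono λ vℓ∈S → anyF-intro _ (φ v) (anyF-intro _ ℓ (∧-intro vℓ∈S (φ-hom v w ℓ v→w)))

    inCount-bound : inCount G K ψ S + ind (S (φ w) ℓ) ≤ inCount G E φ S
    inCount-bound =
      sumF-mono-at (λ x → countF-mono (inPair-restrict x)) (φ w)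
                   (countF-mono-at (inPair-restrict (φ w)) ℓ atℓ)
      where
        inPair-restrict : ∀ x i → S x i ∧ anyF (λ j → (ψ j == x) ∧ hasIn G K ψ j i) ≡ true →
                          S x i ∧ anyF (λ u → (φ u == x) ∧ hasIn G E φ u i) ≡ true
        inPair-restrict x i h =
          ∧-intro (∧-elimˡ (S x i) h) (preimageHasIn-restrict x i (∧-elimʳ (S x i) h))
        inF : anyF (λ u → (φ u == φ w) ∧ hasIn G E φ u ℓ) ≡ true
        inF = anyF-intro (λ u → (φ u == φ w) ∧ hasIn G E φ u ℓ) w
                         (∧-intro (≡⇒== refl) (anyF-intro (λ a → E a w ℓ) v v→w))
        inK : anyF (λ j → (ψ j == φ w) ∧ hasIn G K ψ j ℓ) ≡ false
        inK = anyF-none _ λ j h → ψ≢φw φ-inj j (==⇒≡ (∧-elimˡ (ψ j == φ w) h))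
        atℓ : ind (S (φ w) ℓ ∧ anyF (λ j → (ψ j == φ w) ∧ hasIn G K ψ j ℓ)) + ind (S (φ w) ℓ) ≤
              ind (S (φ w) ℓ ∧ anyF (λ u → (φ u == φ w) ∧ hasIn G E φ u ℓ))
        atℓ rewrite inF | inK | ∧-zeroʳ (S (φ w) ℓ) | ∧-identityʳ (S (φ w) ℓ) = ℕₚ.≤-refl

    slack-bound : ∀ D → slack G K ψ D S ℤ.≤ slack G E φ D S ℤ.+ (+ ind (S (φ v) ℓ) ℤ.+ + ind (S (φ w) ℓ))
    slack-bound D = begin
      sumOver S (λ x i → + D ℤ.- + dC G K ψ x i)     ≤⟨ sumOver-mono S (λ x i _ → pointwise x i) ⟩
      sumOver S (λ x i → slackF x i ℤ.+ (δv x i ℤ.+ δw x i))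
                                                     ≡⟨ sumOver-+ S slackF (λ x i → δv x i ℤ.+ δw x i) ⟩
      sF ℤ.+ sumOver S (λ x i → δv x i ℤ.+ δw x i)   ≡⟨ cong (ℤ._+_ sF) (sumOver-+ S δv δw) ⟩
      sF ℤ.+ (sumOver S δv ℤ.+ sumOver S δw)         ≡⟨ cong (ℤ._+_ sF) (cong₂ ℤ._+_ (sumOver-point S (φ v) ℓ)
                                                                                     (sumOver-point S (φ w) ℓ)) ⟩
      sF ℤ.+ (+ ind (S (φ v) ℓ) ℤ.+ + ind (S (φ w) ℓ)) ∎
      where
        open ℤₚ.≤-Reasoning
        sF = slack G E φ D S
        slackF δv δw : Fin N → Fin n → ℤ
        slackF x i = + D ℤ.- + dC G E φ x i
        δv x i = + δ (φ v) x i
        δw x i = + δ (φ w) x i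
        pointwise : ∀ x i → + D ℤ.- + dC G K ψ x i ℤ.≤ slackF x i ℤ.+ (δv x i ℤ.+ δw x i)
        pointwise x i = subst (λ c → + D ℤ.- + dC G K ψ x i ℤ.≤ slackF x i ℤ.+ c)
                              (ℤₚ.pos-+ (δ (φ v) x i) (δ (φ w) x i))
                              (m-o≤m-n+p D {o = dC G K ψ x i} (dC-leaf-bound x i))

    goodness-restrict : ∀ D → + inCount G E φ S ℤ.+ slack G E φ D S ℤ.≤ + nbrOutside G E φ S →
                        + inCount G K ψ S ℤ.+ slack G K ψ D S ℤ.≤ + nbrOutside G K ψ S
    goodness-restrict D goodF = begin
      iK ℤ.+ slack G K ψ D S                 ≤⟨ ℤₚ.+-monoʳ-≤ iK (slack-bound D) ⟩
      iK ℤ.+ (sF ℤ.+ (+ a ℤ.+ + b))          ≡⟨ regroup iK sF (+ a) (+ b) ⟩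
      (iK ℤ.+ + b) ℤ.+ sF ℤ.+ + a            ≡⟨ cong (λ z → z ℤ.+ sF ℤ.+ + a) (sym (ℤₚ.pos-+ _ b)) ⟩
      + (inCount G K ψ S + b) ℤ.+ sF ℤ.+ + a ≤⟨ ℤₚ.+-monoˡ-≤ (+ a) (ℤₚ.+-monoˡ-≤ sF (ℤ.+≤+ inCount-bound)) ⟩
      + inCount G E φ S ℤ.+ sF ℤ.+ + a       ≤⟨ ℤₚ.+-monoˡ-≤ (+ a) goodF ⟩
      + nbrOutside G E φ S ℤ.+ + a           ≡⟨ sym (ℤₚ.pos-+ _ a) ⟩
      + (nbrOutside G E φ S + a)             ≤⟨ ℤ.+≤+ nbrOutside-bound ⟩
      + nbrOutside G K ψ S                   ∎
      where
        open ℤₚ.≤-Reasoning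
        iK = + inCount G K ψ S
        sF = slack G E φ D S
        a = ind (S (φ v) ℓ)
        b = ind (S (φ w) ℓ)
        regroup : ∀ (i s a b : ℤ) → i ℤ.+ (s ℤ.+ (a ℤ.+ b)) ≡ (i ℤ.+ b) ℤ.+ s ℤ.+ a
        regroup = solve-∀

lemma2p3 : ∀ {N n k : ℕ} (G : Fin n → Graph N) (A : ColorSet N n) (m D : ℕ)
    → 0 < m → 0 < D
    → (E : OEdges (suc k) n) → IsForest E
    → (v w : Fin (suc k)) (ℓ : Fin n) → IsLeaf E w → E v w ℓ ≡ true
    → (φ : Fin (suc k) → Fin N)
    → IsGood G E φ m D A
    → IsGood G (deleteVertex E w) (λ a → φ (punchIn w a)) m D A
lemma2p3 G A m D _ _ E _ v w ℓ leaf v→w φ (embedding@(φ-inj , φ-hom) , good) =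
  isEmbedding-restrict embedding , λ S S⊆A |S|≤m → goodness-restrict S D (good S S⊆A |S|≤m)
  where open LeafDeletion G E leaf v→w φ φ-inj φ-hom
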